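{- Let $t\geq 2$, $r\geq 1$, $n_1,n_2\geq 1$ be integers. Suppose the edges of $K_{n_1,n_2}$, with vertex set $U\sqcup V$, $U=\{u_1,\dots,u_{n_1}\}$, $V=\{v_1,\dots,v_{n_2}\}$, are colored with $r$ colors such that there is no monochromatic and no rainbow subgraph isomorphic to $K_{2,t}$. Then for any distinct $1\le i,j\le n_1$, at least one of $u_i,u_j$ is incident to at least $\frac{n_2-(t-1)(r+1)}{4(t-1)}$ edges of one and the same color.
   Context: A subgraph is monochromatic if all its edges have the same color and rainbow if all its edges have pairwise distinct colors. -}

module Defs where

open import Data.Nat using (ℕ)
open import Data.Fin using (Fin; _≟_)
open import Data.List using (List; filter; length; allFin)
open import Data.Product using (_×_)
open import Relation.Binary.PropositionalEquality using (_≡_; _≢_)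
open import Relation.Nullary using (¬_)
open import Function.Definitions using (Injective)

Coloring : ℕ → ℕ → ℕ → Set
Coloring n₁ n₂ r = Fin n₁ → Fin n₂ → Fin r

-- Edge colouring of a copy of K_{2,t}: two vertices (indexed by Fin 2) on one
-- side, t vertices (indexed by Fin t) on the other; col a i is the colour of
-- the edge between the a-th and the i-th vertex.
Monochromatic : ∀ {t r} → (Fin 2 → Fin t → Fin r) → Set
Monochromatic col = ∀ a b i j → col a i ≡ col b j

Rainbow : ∀ {t r} → (Fin 2 → Fin t → Fin r) → Set
Rainbow col = ∀ a b i j → col a i ≡ col b j → (a ≡ b) × (i ≡ j)

copyUV : ∀ {n₁ n₂ r t} → Coloring n₁ n₂ r → (Fin 2 → Fin n₁) → (Fin t → Fin n₂)
       → Fin 2 → Fin t → Fin r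
copyUV c p q a i = c (p a) (q i)

copyVU : ∀ {n₁ n₂ r t} → Coloring n₁ n₂ r → (Fin 2 → Fin n₂) → (Fin t → Fin n₁)
       → Fin 2 → Fin t → Fin r
copyVU c p q a i = c (q i) (p a)

AllCopies : ∀ {n₁ n₂ r} (t : ℕ) → Coloring n₁ n₂ r
          → ((Fin 2 → Fin t → Fin r) → Set) → Set
AllCopies {n₁} {n₂} t c P =
  (∀ (p : Fin 2 → Fin n₁) (q : Fin t → Fin n₂) →
     Injective _≡_ _≡_ p → Injective _≡_ _≡_ q → P (copyUV c p q))
  × (∀ (p : Fin 2 → Fin n₂) (q : Fin t → Fin n₁) →
     Injective _≡_ _≡_ p → Injective _≡_ _≡_ q → P (copyVU c p q))

NoMonoK2t : ∀ {n₁ n₂ r} (t : ℕ) → Coloring n₁ n₂ r → Set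
NoMonoK2t t c = AllCopies t c (λ col → ¬ Monochromatic col)

NoRainbowK2t : ∀ {n₁ n₂ r} (t : ℕ) → Coloring n₁ n₂ r → Set
NoRainbowK2t t c = AllCopies t c (λ col → ¬ Rainbow col)

colorDeg : ∀ {n₁ n₂ r} → Coloring n₁ n₂ r → Fin n₁ → Fin r → ℕ
colorDeg {n₂ = n₂} c u k = length (filter (λ v → c u v ≟ k) (allFin n₂))

{-# OPTIONS --safe #-}
module Submission where

-- Let u, u' be the two vertices and M the largest number of edges of one colour at u or u'.
-- A vertex v ∈ V whose edges to u and u' both have colour k is one of fewer than t such
-- vertices, or they would span a monochromatic K_{2,t}; so at most r(t−1) vertices see one
-- colour from u and u'. Among the remaining (bichromatic) vertices take a maximal family whose
-- colour pairs are pairwise disjoint: t of them would span a rainbow K_{2,t}, so it has at most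
-- t−1 members, and by maximality every bichromatic vertex shares a colour with one of them,
-- which happens for at most 4M vertices per member. Hence n₂ ≤ r(t−1) + 4(t−1)M.

open import Defs
open import Data.Nat using (ℕ; zero; suc; _≤_; _*_; _∸_; _+_; z≤n; s≤s; _≤?_)
open import Data.Nat.Properties
  using (≤-refl; ≤-trans; ≤-reflexive; n≤1+n; +-suc; +-mono-≤; +-monoˡ-≤; +-monoʳ-≤; *-monoˡ-≤;
         *-monoʳ-≤; *-assoc; *-comm; m≤m+n; ∸-monoʳ-≤; m≤n+o⇒m∸n≤o; ≰⇒>; module ≤-Reasoning)
open import Data.Fin using (Fin; zero; suc; _≟_)
open import Data.Fin.Properties using (all?; any?)
open import Data.List using (List; []; _∷_; length; filter; allFin; cartesianProduct)
open import Data.List.Properties using (filter-accept; filter-none; length-tabulate)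
open import Data.List.Extrema.Nat using (argmax; f[xs]≤f[argmax])
open import Data.List.Membership.Propositional using (_∈_)
open import Data.List.Membership.Propositional.Properties using (∈-filter⁻; ∈-allFin; ∈-cartesianProduct⁺)
open import Data.List.Relation.Unary.All as All using (All; []; _∷_)
open import Data.List.Relation.Unary.All.Properties using (¬All⇒Any¬)
open import Data.List.Relation.Unary.Any as Any using (Any; here; there)
open import Data.List.Relation.Unary.Any.Properties using (¬Any[]; tabulate⁺)
open import Data.List.Relation.Unary.AllPairs using (AllPairs; []; _∷_)
import Data.List.Relation.Unary.Unique.Propositional.Properties as Unique
open import Data.Vec.Functional using () renaming (_∷_ to _◂_; [] to ◂[])
open import Data.Product using (∃-syntax; Σ-syntax; _×_; _,_; proj₁; proj₂; uncurry)
open import Data.Sum using (_⊎_; inj₁; inj₂)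
open import Data.Empty using (⊥-elim)
open import Function.Base using (_∘_; id)
open import Function.Definitions using (Injective)
open import Level using (0ℓ)
open import Relation.Binary.Core using (Rel)
open import Relation.Binary.Definitions using (Symmetric; Decidable)
open import Relation.Binary.PropositionalEquality
  using (_≡_; _≢_; refl; sym; trans; cong; subst; ≢-sym)
open import Relation.Nullary using (¬_; yes; no)
open import Relation.Nullary.Decidable using (decidable-stable; ¬?)
open import Relation.Unary using (Pred) renaming (Decidable to Decidable₁)
open import Relation.Unary.Properties using (∁?)

count : ∀ {A : Set} {P : Pred A 0ℓ} → Decidable₁ P → List A → ℕ
count P? xs = length (filter P? xs)

module _ {A : Set} where

  count-≤-cons : ∀ {P : Pred A 0ℓ} (P? : Decidable₁ P) x xs → count P? xs ≤ count P? (x ∷ xs)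
  count-≤-cons P? x xs with P? x
  ... | yes _ = n≤1+n _
  ... | no _  = ≤-refl

  count-∪ : ∀ {P Q R : Pred A 0ℓ} (P? : Decidable₁ P) (Q? : Decidable₁ Q) (R? : Decidable₁ R)
          → (∀ {x} → P x → Q x ⊎ R x) → ∀ xs → count P? xs ≤ count Q? xs + count R? xs
  count-∪ P? Q? R? P⊆Q∪R [] = z≤n
  count-∪ P? Q? R? P⊆Q∪R (x ∷ xs) with ih ← count-∪ P? Q? R? P⊆Q∪R xs | P? x
  ... | no _ = ≤-trans ih (+-mono-≤ (count-≤-cons Q? x xs) (count-≤-cons R? x xs))
  ... | yes px with P⊆Q∪R px
  ...   | inj₁ qx rewrite filter-accept Q? {xs = xs} qx =
    s≤s (≤-trans ih (+-monoʳ-≤ _ (count-≤-cons R? x xs)))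
  ...   | inj₂ rx rewrite filter-accept R? {xs = xs} rx =
    ≤-trans (s≤s (≤-trans ih (+-monoˡ-≤ _ (count-≤-cons Q? x xs)))) (≤-reflexive (sym (+-suc _ _)))

  length≤count+count∁ : ∀ {P : Pred A 0ℓ} (P? : Decidable₁ P) xs
                      → length xs ≤ count P? xs + count (∁? P?) xs
  length≤count+count∁ P? [] = z≤n
  length≤count+count∁ P? (x ∷ xs) with ih ← length≤count+count∁ P? xs | P? x
  ... | yes _ = s≤s ih
  ... | no _  = ≤-trans (s≤s ih) (≤-reflexive (sym (+-suc _ _)))

  count-≤-cover : ∀ {B : Set} {P : Pred A 0ℓ} {Q : B → Pred A 0ℓ}
                  (P? : Decidable₁ P) (Q? : ∀ w → Decidable₁ (Q w)) {M : ℕ} (ws : List B) (xs : List A)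
                → (∀ {x} → P x → Any (λ w → Q w x) ws) → (∀ w → count (Q? w) xs ≤ M)
                → count P? xs ≤ length ws * M
  count-≤-cover P? Q? [] xs covered _ =
    ≤-reflexive (cong length (filter-none P? (All.universal (λ _ → ¬Any[] ∘ covered) xs)))
  count-≤-cover {Q = Q} P? Q? (w ∷ ws) xs covered Q≤M =
    ≤-trans (count-∪ P? (Q? w) covered-by-ws? (Any.toSum ∘ covered) xs)
            (+-mono-≤ (Q≤M w) (count-≤-cover covered-by-ws? Q? ws xs id Q≤M))
    where
      covered-by-ws? : Decidable₁ (λ x → Any (λ w → Q w x) ws)
      covered-by-ws? x = Any.any? (λ w → Q? w x) ws

  count-≤-cover-Fin : ∀ {m} {P : Pred A 0ℓ} {Q : Fin m → Pred A 0ℓ}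
                      (P? : Decidable₁ P) (Q? : ∀ w → Decidable₁ (Q w)) {M : ℕ} (xs : List A)
                    → (∀ {x} → P x → ∃[ w ] Q w x) → (∀ w → count (Q? w) xs ≤ M)
                    → count P? xs ≤ m * M
  count-≤-cover-Fin {m} P? Q? {M} xs covered Q≤M =
    subst (λ l → count P? xs ≤ l * M) (length-tabulate {n = m} id)
          (count-≤-cover P? Q? (allFin m) xs (λ Px → let w , Qwx = covered Px in tabulate⁺ w Qwx) Q≤M)

module _ {A : Set} {S : Rel A 0ℓ} (S-sym : Symmetric S) where

  select-pairwise : ∀ t {xs} → AllPairs S xs → t ≤ length xs
                  → Σ[ q ∈ (Fin t → A) ] (∀ m → q m ∈ xs) × (∀ {m m'} → m ≢ m' → S (q m) (q m'))
  select-pairwise zero _ _ = (λ ()) , (λ ()) , λ { {()} }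
  select-pairwise (suc t) {x ∷ xs} (S-x-xs ∷ pairwise) (s≤s t≤)
    with q , q∈xs , q-related ← select-pairwise t pairwise t≤ =
    x ◂ q , (λ { zero → here refl ; (suc m) → there (q∈xs m) }) , λ
      { {zero}  {zero}   m≢m' → ⊥-elim (m≢m' refl)
      ; {zero}  {suc m'} _    → All.lookup S-x-xs (q∈xs m')
      ; {suc m} {zero}   _    → S-sym (All.lookup S-x-xs (q∈xs m))
      ; {suc m} {suc m'} m≢m' → q-related (m≢m' ∘ cong suc)
      }

  pairwise-length-≤ : ∀ s {xs} → AllPairs S xs
                    → (∀ (q : Fin (suc s) → A) → (∀ m → q m ∈ xs) → ¬ (∀ {m m'} → m ≢ m' → S (q m) (q m')))
                    → length xs ≤ s
  pairwise-length-≤ s {xs} pairwise no-selection with length xs ≤? s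
  ... | yes ≤s = ≤s
  ... | no ≰s  = let q , q∈ , q-related = select-pairwise (suc s) pairwise (≰⇒> ≰s)
                 in ⊥-elim (no-selection q q∈ q-related)

separating⇒injective : ∀ {t} {B : Set} {q : Fin t → B}
                     → (∀ {m m'} → m ≢ m' → q m ≢ q m') → Injective _≡_ _≡_ q
separating⇒injective separating {m} {m'} qm≡qm' =
  decidable-stable (m ≟ m') (λ m≢m' → separating m≢m' qm≡qm')

Fin2-injective : ∀ {B : Set} {f : Fin 2 → B} → f zero ≢ f (suc zero) → Injective _≡_ _≡_ f
Fin2-injective f₀≢f₁ {zero}     {zero}     _ = refl
Fin2-injective f₀≢f₁ {zero}     {suc zero} e = ⊥-elim (f₀≢f₁ e)
Fin2-injective f₀≢f₁ {suc zero} {zero}     e = ⊥-elim (f₀≢f₁ (sym e))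
Fin2-injective f₀≢f₁ {suc zero} {suc zero} _ = refl

module _ {A : Set} {P : Pred A 0ℓ} {S : Rel A 0ℓ}
         (P? : Decidable₁ P) (S? : Decidable S) (S-irrefl : ∀ {x} → ¬ S x x) where

  record MaximalClique (xs : List A) : Set where
    field
      members   : List A
      members-P : All P members
      pairwise  : AllPairs S members
      maximal   : All (λ x → P x → Any (λ w → ¬ S x w) members) xs

  skip-covered : ∀ {x xs} (K : MaximalClique xs)
               → (P x → Any (λ w → ¬ S x w) (MaximalClique.members K)) → MaximalClique (x ∷ xs)
  skip-covered K covered = record
    { members   = members
    ; members-P = members-P
    ; pairwise  = pairwise
    ; maximal   = covered ∷ maximal
    }
    where open MaximalClique K

  greedy-clique : ∀ xs → MaximalClique xs
  greedy-clique [] = record { members = [] ; members-P = [] ; pairwise = [] ; maximal = [] }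
  greedy-clique (x ∷ xs) with K ← greedy-clique xs | P? x
  ... | no ¬Px = skip-covered K (⊥-elim ∘ ¬Px)
  ... | yes Px with All.all? (S? x) (MaximalClique.members K)
  ...   | no ¬S-x-K = skip-covered K (λ _ → ¬All⇒Any¬ (S? x) _ ¬S-x-K)
  ...   | yes S-x-K = record
    { members   = x ∷ members
    ; members-P = Px ∷ members-P
    ; pairwise  = S-x-K ∷ pairwise
    ; maximal   = (λ _ → here S-irrefl) ∷ All.map (there ∘_) maximal
    }
    where open MaximalClique K

monochromatic-intro : ∀ {t r} {col : Fin 2 → Fin t → Fin r} (k : Fin r)
                    → (∀ a m → col a m ≡ k) → Monochromatic col
monochromatic-intro k constant a b m m' = trans (constant a m) (sym (constant b m'))

rainbow-intro : ∀ {t r} {col : Fin 2 → Fin t → Fin r}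
              → (∀ m → Injective _≡_ _≡_ (λ a → col a m))
              → (∀ {m m'} → m ≢ m' → ∀ a b → col a m ≢ col b m')
              → Rainbow col
rainbow-intro columns-injective columns-disjoint a b m m' e with m ≟ m'
... | yes refl = columns-injective m e , refl
... | no m≢m'  = ⊥-elim (columns-disjoint m≢m' a b e)

argmax-Fin² : ∀ {m n} (f : Fin (suc m) → Fin (suc n) → ℕ)
            → ∃[ a ] ∃[ k ] (∀ a' k' → f a' k' ≤ f a k)
argmax-Fin² {m} {n} f = proj₁ best , proj₂ best , λ a k →
  All.lookup (f[xs]≤f[argmax] {f = uncurry f} (zero , zero) pairs)
             (∈-cartesianProduct⁺ (∈-allFin a) (∈-allFin k))
  where
    pairs : List (Fin (suc m) × Fin (suc n))
    pairs = cartesianProduct (allFin (suc m)) (allFin (suc n))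
    best : Fin (suc m) × Fin (suc n)
    best = argmax (uncurry f) (zero , zero) pairs

module TwoRows {n₁ n₂ r : ℕ} (c : Coloring n₁ n₂ r)
               (p : Fin 2 → Fin n₁) (p-injective : Injective _≡_ _≡_ p) (s : ℕ) where

  row : Fin 2 → Fin n₂ → Fin r
  row a = c (p a)

  Alike : Pred (Fin n₂) 0ℓ
  Alike v = row zero v ≡ row (suc zero) v

  alike? : Decidable₁ Alike
  alike? v = row zero v ≟ row (suc zero) v

  constant? : ∀ k → Decidable₁ (λ v → ∀ a → row a v ≡ k)
  constant? k v = all? (λ a → row a v ≟ k)

  constant-count : NoMonoK2t (suc s) c → ∀ k → count (constant? k) (allFin n₂) ≤ s
  constant-count no-mono k =
    pairwise-length-≤ ≢-sym s (Unique.filter⁺ (constant? k) (Unique.allFin⁺ n₂)) λ q q∈ q-separating →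
      proj₁ no-mono p q p-injective (separating⇒injective q-separating)
            (monochromatic-intro k (λ a m → proj₂ (∈-filter⁻ (constant? k) {xs = allFin n₂} (q∈ m)) a))

  alike-count : NoMonoK2t (suc s) c → count alike? (allFin n₂) ≤ r * s
  alike-count no-mono = count-≤-cover-Fin alike? constant? (allFin n₂) constant-colour (constant-count no-mono)
    where
      constant-colour : ∀ {v} → Alike v → ∃[ k ] ∀ a → row a v ≡ k
      constant-colour {v} alike = row zero v , λ { zero → refl ; (suc zero) → sym alike }

  Meets : Rel (Fin n₂) 0ℓ
  Meets v w = ∃[ a ] ∃[ b ] row a v ≡ row b w

  meets? : Decidable Meets
  meets? v w = any? λ a → any? λ b → row a v ≟ row b w

  Disjoint : Rel (Fin n₂) 0ℓ
  Disjoint v w = ¬ Meets v w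

  disjoint-irrefl : ∀ {v} → ¬ Disjoint v v
  disjoint-irrefl disjoint = disjoint (zero , zero , refl)

  disjoint-sym : Symmetric Disjoint
  disjoint-sym disjoint (a , b , e) = disjoint (b , a , sym e)

  clique : MaximalClique (∁? alike?) (λ v w → ¬? (meets? v w)) disjoint-irrefl (allFin n₂)
  clique = greedy-clique _ _ _ (allFin n₂)

  open MaximalClique clique

  clique-size : NoRainbowK2t (suc s) c → length members ≤ s
  clique-size no-rainbow =
    pairwise-length-≤ disjoint-sym s pairwise λ q q∈ q-disjoint →
      proj₁ no-rainbow p q p-injective
            (separating⇒injective (λ m≢m' e → disjoint-irrefl (subst (Disjoint _) (sym e) (q-disjoint m≢m'))))
            (rainbow-intro (λ m → Fin2-injective (All.lookup members-P (q∈ m)))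
                           (λ m≢m' a b e → q-disjoint m≢m' (a , b , e)))

  module _ {M : ℕ} (degree-≤ : ∀ a k → colorDeg c (p a) k ≤ M) where

    meets-count : ∀ w → count (λ v → meets? v w) (allFin n₂) ≤ 4 * M
    meets-count w = ≤-trans
      (count-≤-cover-Fin (λ v → meets? v w) (λ a v → any? λ b → row a v ≟ row b w) (allFin n₂) id λ a →
        count-≤-cover-Fin _ (λ b v → row a v ≟ row b w) (allFin n₂) id λ b → degree-≤ a (row b w))
      (≤-reflexive (sym (*-assoc 2 2 M)))

    bichromatic-count : NoRainbowK2t (suc s) c → count (∁? alike?) (allFin n₂) ≤ s * (4 * M)
    bichromatic-count no-rainbow = ≤-trans
      (count-≤-cover (∁? alike?) (λ w v → meets? v w) members (allFin n₂) met-by-clique meets-count)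
      (*-monoˡ-≤ (4 * M) (clique-size no-rainbow))
      where
        met-by-clique : ∀ {v} → ¬ Alike v → Any (Meets v) members
        met-by-clique {v} bichromatic =
          Any.map (λ {w} → decidable-stable (meets? v w)) (All.lookup maximal (∈-allFin v) bichromatic)

    size-≤ : NoMonoK2t (suc s) c → NoRainbowK2t (suc s) c → n₂ ≤ r * s + s * (4 * M)
    size-≤ no-mono no-rainbow = begin
      n₂                                                  ≡⟨ length-tabulate {n = n₂} id ⟨
      length (allFin n₂)                                  ≤⟨ length≤count+count∁ alike? (allFin n₂) ⟩
      count alike? (allFin n₂) + count (∁? alike?) (allFin n₂)
                                                          ≤⟨ +-mono-≤ (alike-count no-mono) (bichromatic-count no-rainbow) ⟩
      r * s + s * (4 * M)                                 ∎
      where open ≤-Reasoning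

    degree-bound : NoMonoK2t (suc s) c → NoRainbowK2t (suc s) c → n₂ ∸ s * (r + 1) ≤ 4 * s * M
    degree-bound no-mono no-rainbow = begin
      n₂ ∸ s * (r + 1)  ≤⟨ ∸-monoʳ-≤ n₂ (≤-trans (≤-reflexive (*-comm r s)) (*-monoʳ-≤ s (m≤m+n r 1))) ⟩
      n₂ ∸ r * s        ≤⟨ m≤n+o⇒m∸n≤o n₂ (r * s) (size-≤ no-mono no-rainbow) ⟩
      s * (4 * M)       ≡⟨ *-assoc s 4 M ⟨
      s * 4 * M         ≡⟨ cong (_* M) (*-comm s 4) ⟩
      4 * s * M         ∎
      where open ≤-Reasoning

lemma3 : (t r n₁ n₂ : ℕ) → 2 ≤ t → 1 ≤ r → 1 ≤ n₁ → 1 ≤ n₂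
       → (c : Coloring n₁ n₂ r)
       → NoMonoK2t t c → NoRainbowK2t t c
       → (i j : Fin n₁) → i ≢ j
       → ∃[ k ] (n₂ ∸ (t ∸ 1) * (r + 1) ≤ 4 * (t ∸ 1) * colorDeg c i k)
         ⊎ ∃[ k ] (n₂ ∸ (t ∸ 1) * (r + 1) ≤ 4 * (t ∸ 1) * colorDeg c j k)
lemma3 (suc s) (suc r) n₁ n₂ (s≤s _) _ _ _ c no-mono no-rainbow i j i≢j =
  heaviest (argmax-Fin² (colorDeg c ∘ pair))
  where
    pair : Fin 2 → Fin n₁
    pair = i ◂ j ◂ ◂[]
    open TwoRows c pair (Fin2-injective {f = pair} i≢j) s using (degree-bound)

    Heavy : Fin n₁ → Set
    Heavy u = ∃[ k ] (n₂ ∸ s * (suc r + 1) ≤ 4 * s * colorDeg c u k)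

    heaviest : (∃[ a ] ∃[ k ] ∀ a' k' → colorDeg c (pair a') k' ≤ colorDeg c (pair a) k)
             → Heavy i ⊎ Heavy j
    heaviest (zero     , k , maximal) = inj₁ (k , degree-bound maximal no-mono no-rainbow)
    heaviest (suc zero , k , maximal) = inj₂ (k , degree-bound maximal no-mono no-rainbow)
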